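{- Let $k\geq3$ be an integer. For $n\geq1$ let $M_{k,n}=[\underbrace{k,\ldots,k}_{n}]$, $m_{k,n}=[\underbrace{k,\ldots,k}_{n},1]$, and let $G_{k,n}=\left(M_{k,n}+m_{k,n},\,2M_{k,n+1}\right)$ if $n$ is odd and $G_{k,n}=\left(2M_{k,n+1},\,M_{k,n}+m_{k,n}\right)$ if $n$ is even. Then the intervals $G_{k,n}$, $n\geq1$, are pairwise disjoint.
   Context: $[a_1,\ldots,a_n]$ denotes the finite regular continued fraction $1/(a_1+1/(\cdots+1/a_n))$.
   Formalization: The intervals $G_{k,n}$ are taken as sets of rational numbers, so pairwise disjointness is asserted for rational points only. -}

module Defs where

open import Data.Nat as ℕ using (ℕ; zero; suc; _%_)
open import Data.Integer using (+_)
open import Data.List using (List; []; _∷_; replicate; _++_)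
open import Data.Product using (_×_; _,_; proj₁; proj₂)
open import Data.Rational as ℚ using (ℚ; 0ℚ; _/_; 1/_; _+_; _*_; _<_; ≢-nonZero)
open import Data.Rational.Properties using (_≟_)
open import Relation.Nullary using (yes; no)

ℕ→ℚ : ℕ → ℚ
ℕ→ℚ a = + a / 1

-- reciprocal, with the (never used here) convention 1/0 = 0
inv : ℚ → ℚ
inv x with x ≟ 0ℚ
... | yes _ = 0ℚ
... | no x≢0 = 1/_ x {{≢-nonZero x≢0}}

-- [a₁,…,aₙ] = 1/(a₁ + 1/(⋯ + 1/aₙ)), with [] = 0 so that [a] = 1/a
cf : List ℕ → ℚ
cf [] = 0ℚ
cf (a ∷ as) = inv (ℕ→ℚ a + cf as)

M : ℕ → ℕ → ℚ
M k n = cf (replicate n k)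

m : ℕ → ℕ → ℚ
m k n = cf (replicate n k ++ (1 ∷ []))

G : ℕ → ℕ → ℚ × ℚ
G k n with n % 2
... | 1 = (M k n + m k n , ℕ→ℚ 2 * M k (suc n))
... | _ = (ℕ→ℚ 2 * M k (suc n) , M k n + m k n)

_∈G[_,_] : ℚ → ℕ → ℕ → Set
x ∈G[ k , n ] = (proj₁ (G k n) < x) Data.Product.× (x < proj₂ (G k n))

-- Write Fₙ for the k-Fibonacci numbers (F₀ = 0, F₁ = 1, Fₙ₊₂ = k Fₙ₊₁ + Fₙ). Then
-- M_{k,n} = Fₙ / Fₙ₊₁ and m_{k,n} = (Fₙ₋₁ + Fₙ) / (Fₙ + Fₙ₊₁), and after cross-multiplying,
-- Cassini's identity Fₙ₊₁² − Fₙ Fₙ₊₂ = (−1)ⁿ yields every inequality needed: the even-indexed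
-- M_{k,n} increase, the odd-indexed ones decrease, each even-indexed one lies below each
-- odd-indexed one, and 2M_{k,n−1} ≤ M_{k,n} + m_{k,n} for odd n, with ≥ for even n. So G_{k,n}
-- lies strictly between 2M_{k,n−1} and 2M_{k,n+1}. For odd n these gaps are consecutive along the
-- increasing chain 2M_{k,0} ≤ 2M_{k,2} ≤ ⋯, for even n along the decreasing chain
-- ⋯ ≤ 2M_{k,3} ≤ 2M_{k,1}, and the first chain lies below the second, so no two gaps meet.
module Submission where

open import Defs
open import Data.Empty using (⊥)
open import Data.Integer.Base as ℤ using (ℤ; +_; +[1+_]; -[1+_])
import Data.Integer.Properties as ℤ
open import Algebra.Properties.CommutativeSemigroup ℤ.*-commutativeSemigroup
  using (interchange; xy∙z≈xz∙y)
import Data.Integer.Tactic.RingSolver as ℤ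
open import Data.List.Base using ([]; _∷_; replicate; _++_)
open import Data.List.Properties using (++-identityʳ)
open import Data.Nat.Base as ℕ using (ℕ; zero; suc; _+_; _*_; _≤_; _<_; _%_; s≤s; NonZero)
import Data.Nat.Properties as ℕ
open import Data.Nat.Tactic.RingSolver using (solve-∀; solve)
open import Data.Product using (_×_; _,_; proj₁; proj₂)
open import Data.Rational.Base as ℚ using (ℚ; mkℚ; toℚᵘ)
import Data.Rational.Properties as ℚ
open import Data.Rational.Unnormalised.Base as ℚᵘ using (ℚᵘ; mkℚᵘ; ↥_; ↧_; *≡*; *≤*)
import Data.Rational.Unnormalised.Properties as ℚᵘ
open import Function using (flip; _∘_)
open import Relation.Binary using (Rel; Reflexive; Transitive; tri<; tri≈; tri>)
open import Relation.Binary.PropositionalEquality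
open import Relation.Nullary using (no; ¬_)

infix 4 _≐_/_

-- p = a / b, where a / b need not be in lowest terms
data _≐_/_ (p : ℚᵘ) (a b : ℕ) : Set where
  cross : ↥ p ℤ.* + b ≡ + a ℤ.* ↧ p → p ≐ a / b

≐-resp-≃ : ∀ {p q a b} → p ℚᵘ.≃ q → p ≐ a / b → q ≐ a / b
≐-resp-≃ {mkℚᵘ x e} {mkℚᵘ y f} {a} {b} (*≡* x*F≡y*E) (cross x*b≡a*E) =
  cross (ℤ.*-cancelʳ-≡ _ _ E (begin
    y ℤ.* + b ℤ.* E  ≡⟨ xy∙z≈xz∙y y (+ b) E ⟩
    y ℤ.* E ℤ.* + b  ≡⟨ cong (ℤ._* + b) x*F≡y*E ⟨
    x ℤ.* F ℤ.* + b  ≡⟨ xy∙z≈xz∙y x F (+ b) ⟩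
    x ℤ.* + b ℤ.* F  ≡⟨ cong (ℤ._* F) x*b≡a*E ⟩
    + a ℤ.* E ℤ.* F  ≡⟨ xy∙z≈xz∙y (+ a) E F ⟩
    + a ℤ.* F ℤ.* E  ∎))
  where
  open ≡-Reasoning
  E F : ℤ
  E = +[1+ e ]
  F = +[1+ f ]

cross-+ : ∀ x y a b c d e f → x ℤ.* b ≡ a ℤ.* e → y ℤ.* d ≡ c ℤ.* f →
          (x ℤ.* f ℤ.+ y ℤ.* e) ℤ.* (b ℤ.* d) ≡ (a ℤ.* d ℤ.+ c ℤ.* b) ℤ.* (e ℤ.* f)
cross-+ x y a b c d e f x*b≡a*e y*d≡c*f = begin
  (x ℤ.* f ℤ.+ y ℤ.* e) ℤ.* (b ℤ.* d)              ≡⟨ ℤ.solve (x ∷ y ∷ b ∷ d ∷ e ∷ f ∷ []) ⟩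
  x ℤ.* b ℤ.* (f ℤ.* d) ℤ.+ y ℤ.* d ℤ.* (e ℤ.* b)
    ≡⟨ cong₂ (λ u v → u ℤ.* (f ℤ.* d) ℤ.+ v ℤ.* (e ℤ.* b)) x*b≡a*e y*d≡c*f ⟩
  a ℤ.* e ℤ.* (f ℤ.* d) ℤ.+ c ℤ.* f ℤ.* (e ℤ.* b)  ≡⟨ ℤ.solve (a ∷ b ∷ c ∷ d ∷ e ∷ f ∷ []) ⟩
  (a ℤ.* d ℤ.+ c ℤ.* b) ℤ.* (e ℤ.* f)              ∎
  where open ≡-Reasoning

≐-+ : ∀ {p q a b c d} → p ≐ a / b → q ≐ c / d → p ℚᵘ.+ q ≐ (a * d + c * b) / (b * d)
≐-+ {mkℚᵘ x e} {mkℚᵘ y f} {a} {b} {c} {d} (cross x*b≡a*E) (cross y*d≡c*F) = cross (begin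
  (x ℤ.* F ℤ.+ y ℤ.* E) ℤ.* + (b * d)          ≡⟨ cong ((x ℤ.* F ℤ.+ y ℤ.* E) ℤ.*_) (ℤ.pos-* b d) ⟩
  (x ℤ.* F ℤ.+ y ℤ.* E) ℤ.* (+ b ℤ.* + d)      ≡⟨ cross-+ x y (+ a) (+ b) (+ c) (+ d) E F x*b≡a*E y*d≡c*F ⟩
  (+ a ℤ.* + d ℤ.+ + c ℤ.* + b) ℤ.* (E ℤ.* F)
    ≡⟨ cong (ℤ._* (E ℤ.* F)) (cong₂ ℤ._+_ (ℤ.pos-* a d) (ℤ.pos-* c b)) ⟨
  (+ (a * d) ℤ.+ + (c * b)) ℤ.* (E ℤ.* F)
    ≡⟨ cong₂ ℤ._*_ (ℤ.pos-+ (a * d) (c * b)) (ℤ.pos-* (suc e) (suc f)) ⟨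
  + (a * d + c * b) ℤ.* + (suc e * suc f)      ∎)
  where
  open ≡-Reasoning
  E F : ℤ
  E = +[1+ e ]
  F = +[1+ f ]

≐-* : ∀ {p q a b c d} → p ≐ a / b → q ≐ c / d → p ℚᵘ.* q ≐ (a * c) / (b * d)
≐-* {mkℚᵘ x e} {mkℚᵘ y f} {a} {b} {c} {d} (cross x*b≡a*E) (cross y*d≡c*F) = cross (begin
  x ℤ.* y ℤ.* + (b * d)            ≡⟨ cong (x ℤ.* y ℤ.*_) (ℤ.pos-* b d) ⟩
  x ℤ.* y ℤ.* (+ b ℤ.* + d)        ≡⟨ interchange x y (+ b) (+ d) ⟩
  x ℤ.* + b ℤ.* (y ℤ.* + d)        ≡⟨ cong₂ ℤ._*_ x*b≡a*E y*d≡c*F ⟩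
  + a ℤ.* E ℤ.* (+ c ℤ.* F)        ≡⟨ interchange (+ a) E (+ c) F ⟩
  + a ℤ.* + c ℤ.* (E ℤ.* F)        ≡⟨ cong₂ ℤ._*_ (ℤ.pos-* a c) (ℤ.pos-* (suc e) (suc f)) ⟨
  + (a * c) ℤ.* + (suc e * suc f)  ∎)
  where
  open ≡-Reasoning
  E F : ℤ
  E = +[1+ e ]
  F = +[1+ f ]

≐-≤ : ∀ {p q a b c d} → p ≐ a / b → q ≐ c / d → 0 < b → 0 < d → a * d ≤ c * b → p ℚᵘ.≤ q
≐-≤ {a = a} {suc b} {c} {suc d} (cross p-cross) (cross q-cross) _ _ a*d≤c*b =
  ℚᵘ.≤-respˡ-≃ (*≡* (sym p-cross)) (ℚᵘ.≤-respʳ-≃ (*≡* (sym q-cross))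
    (*≤* {mkℚᵘ (+ a) b} {mkℚᵘ (+ c) d} (begin
      + a ℤ.* + suc d  ≡⟨ ℤ.pos-* a (suc d) ⟨
      + (a * suc d)    ≤⟨ ℤ.+≤+ a*d≤c*b ⟩
      + (c * suc b)    ≡⟨ ℤ.pos-* c (suc b) ⟩
      + c ℤ.* + suc b  ∎)))
  where open ℤ.≤-Reasoning

≐-+ℚ : ∀ {x y a b c d} → toℚᵘ x ≐ a / b → toℚᵘ y ≐ c / d → toℚᵘ (x ℚ.+ y) ≐ (a * d + c * b) / (b * d)
≐-+ℚ {x} {y} x≐a/b y≐c/d = ≐-resp-≃ (ℚᵘ.≃-sym (ℚ.toℚᵘ-homo-+ x y)) (≐-+ x≐a/b y≐c/d)

≐-*ℚ : ∀ {x y a b c d} → toℚᵘ x ≐ a / b → toℚᵘ y ≐ c / d → toℚᵘ (x ℚ.* y) ≐ (a * c) / (b * d)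
≐-*ℚ {x} {y} x≐a/b y≐c/d = ≐-resp-≃ (ℚᵘ.≃-sym (ℚ.toℚᵘ-homo-* x y)) (≐-* x≐a/b y≐c/d)

≐-≤ℚ : ∀ {x y a b c d} → toℚᵘ x ≐ a / b → toℚᵘ y ≐ c / d → 0 < b → 0 < d → a * d ≤ c * b → x ℚ.≤ y
≐-≤ℚ x≐a/b y≐c/d 0<b 0<d a*d≤c*b = ℚ.toℚᵘ-cancel-≤ (≐-≤ x≐a/b y≐c/d 0<b 0<d a*d≤c*b)

ℕ→ℚ-≐ : ∀ a → toℚᵘ (ℕ→ℚ a) ≐ a / 1
ℕ→ℚ-≐ a = ≐-resp-≃ (ℚᵘ.≃-sym (ℚ.toℚᵘ-fromℚᵘ (mkℚᵘ (+ a) 0))) (cross refl)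

inv-≐ : ∀ {x a b} → toℚᵘ x ≐ a / b → 0 < a → 0 < b → toℚᵘ (inv x) ≐ b / a
inv-≐ {mkℚ (+ zero) _ _} (cross ()) ℕ.z<s ℕ.z<s
inv-≐ {mkℚ -[1+ _ ] _ _} (cross ()) ℕ.z<s ℕ.z<s
inv-≐ {x@(mkℚ +[1+ n ] d _)} {a} {b} (cross x-cross) _ _ with x ℚ.≟ ℚ.0ℚ
... | no _ = cross (trans (ℤ.*-comm +[1+ d ] (+ a)) (trans (sym x-cross) (ℤ.*-comm +[1+ n ] (+ b))))

inv-+-≐ : ∀ k .{{_ : NonZero k}} {y a b} → toℚᵘ y ≐ a / b → 0 < b →
          toℚᵘ (inv (ℕ→ℚ k ℚ.+ y)) ≐ b / (k * b + a)
inv-+-≐ k {y} {a} {b} y≐a/b 0<b = inv-≐ k+y≐ 0<k*b+a 0<b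
  where
  k+y≐ : toℚᵘ (ℕ→ℚ k ℚ.+ y) ≐ (k * b + a) / b
  k+y≐ = subst₂ (toℚᵘ (ℕ→ℚ k ℚ.+ y) ≐_/_) (cong (λ t → k * b + t) (ℕ.*-identityʳ a)) (ℕ.*-identityˡ b)
           (≐-+ℚ (ℕ→ℚ-≐ k) y≐a/b)
  0<k*b+a : 0 < k * b + a
  0<k*b+a = ℕ.≤-trans (ℕ.≤-trans 0<b (ℕ.m≤n*m b k)) (ℕ.m≤m+n (k * b) a)

horadam : ℕ → ℕ → ℕ → ℕ → ℕ
horadam k a b zero = a
horadam k a b (suc zero) = b
horadam k a b (suc (suc n)) = k * horadam k a b (suc n) + horadam k a b n

fib : ℕ → ℕ → ℕ
fib k = horadam k 0 1

horadam-pos : ∀ k .{{_ : NonZero k}} {a b} → 0 < b → ∀ n → 0 < horadam k a b (suc n)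
horadam-pos k 0<b zero = 0<b
horadam-pos k {a} {b} 0<b (suc n) =
  ℕ.≤-trans (horadam-pos k 0<b n) (ℕ.≤-trans (ℕ.m≤n*m _ k) (ℕ.m≤m+n _ (horadam k a b n)))

fib-pos : ∀ k .{{_ : NonZero k}} n → 0 < fib k (suc n)
fib-pos k = horadam-pos k ℕ.z<s

horadam-1-1 : ∀ k n → horadam k 1 1 (suc n) ≡ fib k n + fib k (suc n)
horadam-1-1 k zero = refl
horadam-1-1 k (suc zero) = trans (ℕ.+-comm (k * 1) 1) (cong suc (sym (ℕ.+-identityʳ (k * 1))))
horadam-1-1 k (suc (suc n)) = begin
  k * horadam k 1 1 (2 + n) + horadam k 1 1 (1 + n)
    ≡⟨ cong₂ (λ x y → k * x + y) (horadam-1-1 k (suc n)) (horadam-1-1 k n) ⟩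
  k * (fib k (1 + n) + fib k (2 + n)) + (fib k n + fib k (1 + n))
    ≡⟨ regroup k (fib k n) (fib k (suc n)) ⟩
  fib k (2 + n) + fib k (3 + n) ∎
  where
  open ≡-Reasoning
  regroup : ∀ k a b → k * (b + (k * b + a)) + (a + b) ≡ k * b + a + (k * (k * b + a) + b)
  regroup = solve-∀

cassini-step : ∀ k a b {e e′} → b * b + e ≡ a * (k * b + a) + e′ →
               (k * b + a) * (k * b + a) + e′ ≡ b * (k * (k * b + a) + b) + e
cassini-step k a b {e} {e′} b*b+e≡a*c+e′ = begin
  (k * b + a) * (k * b + a) + e′                ≡⟨ solve (k ∷ a ∷ b ∷ e′ ∷ []) ⟩
  k * b * (k * b + a) + (a * (k * b + a) + e′)  ≡⟨ cong (k * b * (k * b + a) ℕ.+_) b*b+e≡a*c+e′ ⟨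
  k * b * (k * b + a) + (b * b + e)             ≡⟨ solve (k ∷ a ∷ b ∷ e ∷ []) ⟩
  b * (k * (k * b + a) + b) + e                 ∎
  where open ≡-Reasoning

-- Cassini's identity Fₙ₊₁² − Fₙ Fₙ₊₂ = (−1)ⁿ, with both sides moved into ℕ
cassini : ∀ k n → fib k (1 + n) * fib k (1 + n) + n % 2 ≡ fib k n * fib k (2 + n) + (1 + n) % 2
cassini k zero = refl
cassini k (suc n) = cassini-step k (fib k n) (fib k (suc n)) (cassini k n)

double : ℕ → ℕ
double zero = zero
double (suc i) = suc (suc (double i))

double%2≡0 : ∀ i → double i % 2 ≡ 0
double%2≡0 zero = refl
double%2≡0 (suc i) = double%2≡0 i

1+double%2≡1 : ∀ i → (1 + double i) % 2 ≡ 1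
1+double%2≡1 zero = refl
1+double%2≡1 (suc i) = 1+double%2≡1 i

data Parity : ℕ → Set where
  even : ∀ i → Parity (double i)
  odd  : ∀ i → Parity (1 + double i)

parity : ∀ n → Parity n
parity zero = even 0
parity (suc n) with parity n
... | even i = odd i
... | odd i = even (suc i)

m+0≡n+1⇒n≤m : ∀ {m n} → m + 0 ≡ n + 1 → n ≤ m
m+0≡n+1⇒n≤m {m} {n} m+0≡n+1 = begin
  n      ≤⟨ ℕ.m≤m+n n 1 ⟩
  n + 1  ≡⟨ m+0≡n+1 ⟨
  m + 0  ≡⟨ ℕ.+-identityʳ m ⟩
  m      ∎
  where open ℕ.≤-Reasoning

cassini-even : ∀ k i → fib k (double i) * fib k (2 + double i) ≤ fib k (1 + double i) * fib k (1 + double i)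
cassini-even k i with cassini k (double i)
... | identity rewrite double%2≡0 i | 1+double%2≡1 i = m+0≡n+1⇒n≤m identity

cassini-odd : ∀ k i → fib k (2 + double i) * fib k (2 + double i) ≤ fib k (1 + double i) * fib k (3 + double i)
cassini-odd k i with cassini k (1 + double i)
... | identity rewrite 1+double%2≡1 i | double%2≡0 (suc i) = m+0≡n+1⇒n≤m (sym identity)

-- for c = k b + a and d = k c + b: a / b ≤ b / c implies a / b ≤ c / d, and likewise for ≥
recurrence-cross-≤ : ∀ k a b → a * (k * b + a) ≤ b * b → a * (k * (k * b + a) + b) ≤ (k * b + a) * b
recurrence-cross-≤ k a b a*c≤b*b = begin
  a * (k * (k * b + a) + b)      ≡⟨ solve (k ∷ a ∷ b ∷ []) ⟩
  k * (a * (k * b + a)) + a * b  ≤⟨ ℕ.+-monoˡ-≤ (a * b) (ℕ.*-monoʳ-≤ k a*c≤b*b) ⟩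
  k * (b * b) + a * b            ≡⟨ solve (k ∷ a ∷ b ∷ []) ⟩
  (k * b + a) * b                ∎
  where open ℕ.≤-Reasoning

recurrence-cross-≥ : ∀ k a b → b * b ≤ a * (k * b + a) → (k * b + a) * b ≤ a * (k * (k * b + a) + b)
recurrence-cross-≥ k a b b*b≤a*c = begin
  (k * b + a) * b                ≡⟨ solve (k ∷ a ∷ b ∷ []) ⟩
  k * (b * b) + a * b            ≤⟨ ℕ.+-monoˡ-≤ (a * b) (ℕ.*-monoʳ-≤ k b*b≤a*c) ⟩
  k * (a * (k * b + a)) + a * b  ≡⟨ solve (k ∷ a ∷ b ∷ []) ⟩
  a * (k * (k * b + a) + b)      ∎
  where open ℕ.≤-Reasoning

-- cross-multiplied comparisons of 2u / v with v / w + (u + v) / (v + w)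
cross-twice≤sum : ∀ u v w → u * w ≤ v * v → 2 * u * (w * (v + w)) ≤ (v * (v + w) + (u + v) * w) * v
cross-twice≤sum u v w u*w≤v*v = begin
  2 * u * (w * (v + w))              ≡⟨ solve (u ∷ v ∷ w ∷ []) ⟩
  u * w * (v + 2 * w) + u * (v * w)  ≤⟨ ℕ.+-monoˡ-≤ (u * (v * w)) (ℕ.*-monoˡ-≤ (v + 2 * w) u*w≤v*v) ⟩
  v * v * (v + 2 * w) + u * (v * w)  ≡⟨ solve (u ∷ v ∷ w ∷ []) ⟩
  (v * (v + w) + (u + v) * w) * v    ∎
  where open ℕ.≤-Reasoning

cross-sum≤twice : ∀ u v w → v * v ≤ u * w → (v * (v + w) + (u + v) * w) * v ≤ 2 * u * (w * (v + w))
cross-sum≤twice u v w v*v≤u*w = begin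
  (v * (v + w) + (u + v) * w) * v    ≡⟨ solve (u ∷ v ∷ w ∷ []) ⟩
  v * v * (v + 2 * w) + u * (v * w)  ≤⟨ ℕ.+-monoˡ-≤ (u * (v * w)) (ℕ.*-monoˡ-≤ (v + 2 * w) v*v≤u*w) ⟩
  u * w * (v + 2 * w) + u * (v * w)  ≡⟨ solve (u ∷ v ∷ w ∷ []) ⟩
  2 * u * (w * (v + w))              ∎
  where open ℕ.≤-Reasoning

step⇒mono : ∀ {a ℓ} {A : Set a} {_∼_ : Rel A ℓ} → Reflexive _∼_ → Transitive _∼_ →
            (f : ℕ → A) → (∀ i → f i ∼ f (suc i)) → ∀ {i j} → i ≤ j → f i ∼ f j
step⇒mono {_∼_ = _∼_} refl∼ trans∼ f step {i} i≤j = chain (ℕ.≤⇒≤′ i≤j)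
  where
  chain : ∀ {j} → i ℕ.≤′ j → f i ∼ f j
  chain ℕ.≤′-refl = refl∼
  chain (ℕ.≤′-step i≤′j) = trans∼ (chain i≤′j) (step _)

<-≤-<-irrefl : ∀ {x a b} → x ℚ.< a → a ℚ.≤ b → b ℚ.< x → ⊥
<-≤-<-irrefl x<a a≤b b<x = ℚ.<-irrefl refl (ℚ.<-trans x<a (ℚ.≤-<-trans a≤b b<x))

cf-replicate-≐ : ∀ k .{{_ : NonZero k}} {as a b} → toℚᵘ (cf as) ≐ a / b → 0 < b → ∀ n →
                 toℚᵘ (cf (replicate n k ++ as)) ≐ horadam k a b n / horadam k a b (suc n)
cf-replicate-≐ k as≐a/b 0<b zero = as≐a/b
cf-replicate-≐ k as≐a/b 0<b (suc n) = inv-+-≐ k (cf-replicate-≐ k as≐a/b 0<b n) (horadam-pos k 0<b n)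

module _ (k : ℕ) .{{_ : NonZero k}} where

  M-≐ : ∀ n → toℚᵘ (M k n) ≐ fib k n / fib k (suc n)
  M-≐ n = subst (λ as → toℚᵘ (cf as) ≐ fib k n / fib k (suc n)) (++-identityʳ (replicate n k))
            (cf-replicate-≐ k (cross refl) ℕ.z<s n)

  m-≐ : ∀ n → toℚᵘ (m k n) ≐ horadam k 1 1 n / horadam k 1 1 (suc n)
  m-≐ = cf-replicate-≐ k (cross refl) ℕ.z<s

  2M-≐ : ∀ n → toℚᵘ (ℕ→ℚ 2 ℚ.* M k n) ≐ (2 * fib k n) / fib k (1 + n)
  2M-≐ n = subst (toℚᵘ (ℕ→ℚ 2 ℚ.* M k n) ≐ 2 * fib k n /_) (ℕ.*-identityˡ _) (≐-*ℚ (ℕ→ℚ-≐ 2) (M-≐ n))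

  M+m-≐ : ∀ n → let u = fib k n; v = fib k (1 + n); w = fib k (2 + n) in
          toℚᵘ (M k (1 + n) ℚ.+ m k (1 + n)) ≐ (v * (v + w) + (u + v) * w) / (w * (v + w))
  M+m-≐ n = subst₂ (λ W₁ W₂ → toℚᵘ (M k (1 + n) ℚ.+ m k (1 + n))
                               ≐ (fib k (1 + n) * W₂ + W₁ * fib k (2 + n)) / (fib k (2 + n) * W₂))
              (horadam-1-1 k n) (horadam-1-1 k (1 + n)) (≐-+ℚ (M-≐ (1 + n)) (m-≐ (1 + n)))

  M+m-denominator-pos : ∀ n → 0 < fib k (2 + n) * (fib k (1 + n) + fib k (2 + n))
  M+m-denominator-pos n =
    ℕ.*-mono-≤ (fib-pos k (1 + n)) (ℕ.≤-trans (fib-pos k (1 + n)) (ℕ.m≤n+m _ (fib k (1 + n))))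

  M≤M-suc : ∀ n → fib k n * fib k (2 + n) ≤ fib k (1 + n) * fib k (1 + n) → M k n ℚ.≤ M k (1 + n)
  M≤M-suc n = ≐-≤ℚ (M-≐ n) (M-≐ (1 + n)) (fib-pos k n) (fib-pos k (1 + n))

  M≤M-2+ : ∀ n → fib k n * fib k (2 + n) ≤ fib k (1 + n) * fib k (1 + n) → M k n ℚ.≤ M k (2 + n)
  M≤M-2+ n = ≐-≤ℚ (M-≐ n) (M-≐ (2 + n)) (fib-pos k n) (fib-pos k (2 + n))
             ∘ recurrence-cross-≤ k (fib k n) (fib k (1 + n))

  M-2+≤M : ∀ n → fib k (1 + n) * fib k (1 + n) ≤ fib k n * fib k (2 + n) → M k (2 + n) ℚ.≤ M k n
  M-2+≤M n = ≐-≤ℚ (M-≐ (2 + n)) (M-≐ n) (fib-pos k (2 + n)) (fib-pos k n)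
             ∘ recurrence-cross-≥ k (fib k n) (fib k (1 + n))

  2M≤M+m : ∀ n → fib k n * fib k (2 + n) ≤ fib k (1 + n) * fib k (1 + n) →
           ℕ→ℚ 2 ℚ.* M k n ℚ.≤ M k (1 + n) ℚ.+ m k (1 + n)
  2M≤M+m n = ≐-≤ℚ (2M-≐ n) (M+m-≐ n) (fib-pos k n) (M+m-denominator-pos n)
             ∘ cross-twice≤sum (fib k n) (fib k (1 + n)) (fib k (2 + n))

  M+m≤2M : ∀ n → fib k (1 + n) * fib k (1 + n) ≤ fib k n * fib k (2 + n) →
           M k (1 + n) ℚ.+ m k (1 + n) ℚ.≤ ℕ→ℚ 2 ℚ.* M k n
  M+m≤2M n = ≐-≤ℚ (M+m-≐ n) (2M-≐ n) (M+m-denominator-pos n) (fib-pos k n)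
             ∘ cross-sum≤twice (fib k n) (fib k (1 + n)) (fib k (2 + n))

  M-even-mono : ∀ {i j} → i ≤ j → M k (double i) ℚ.≤ M k (double j)
  M-even-mono = step⇒mono {_∼_ = ℚ._≤_} ℚ.≤-refl ℚ.≤-trans (M k ∘ double)
                  (λ i → M≤M-2+ (double i) (cassini-even k i))

  M-odd-antimono : ∀ {i j} → i ≤ j → M k (1 + double j) ℚ.≤ M k (1 + double i)
  M-odd-antimono = step⇒mono {_∼_ = flip ℚ._≤_} ℚ.≤-refl (flip ℚ.≤-trans) (M k ∘ suc ∘ double)
                     (λ i → M-2+≤M (1 + double i) (cassini-odd k i))

  M-even≤M-odd : ∀ i j → M k (double i) ℚ.≤ M k (1 + double j)
  M-even≤M-odd i j = begin
    M k (double i)          ≤⟨ M-even-mono (ℕ.m≤m⊔n i j) ⟩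
    M k (double l)          ≤⟨ M≤M-suc (double l) (cassini-even k l) ⟩
    M k (1 + double l)      ≤⟨ M-odd-antimono (ℕ.m≤n⊔m i j) ⟩
    M k (1 + double j)      ∎
    where
    open ℚ.≤-Reasoning
    l = i ℕ.⊔ j

  ∈G-odd : ∀ i {x} → x ∈G[ k , 1 + double i ] →
           ℕ→ℚ 2 ℚ.* M k (double i) ℚ.< x × x ℚ.< ℕ→ℚ 2 ℚ.* M k (2 + double i)
  ∈G-odd i x∈G rewrite 1+double%2≡1 i =
    ℚ.≤-<-trans (2M≤M+m (double i) (cassini-even k i)) (proj₁ x∈G) , proj₂ x∈G

  ∈G-even : ∀ i {x} → x ∈G[ k , 2 + double i ] →
            ℕ→ℚ 2 ℚ.* M k (3 + double i) ℚ.< x × x ℚ.< ℕ→ℚ 2 ℚ.* M k (1 + double i)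
  ∈G-even i x∈G rewrite double%2≡0 (suc i) =
    proj₁ x∈G , ℚ.<-≤-trans (proj₂ x∈G) (M+m≤2M (1 + double i) (cassini-odd k i))

  G-odd-disjoint : ∀ {i j x} → i < j → x ∈G[ k , 1 + double i ] → x ∈G[ k , 1 + double j ] → ⊥
  G-odd-disjoint {i} {j} i<j x∈Gi x∈Gj = <-≤-<-irrefl (proj₂ (∈G-odd i x∈Gi))
    (ℚ.*-monoˡ-≤-nonNeg (ℕ→ℚ 2) (M-even-mono i<j)) (proj₁ (∈G-odd j x∈Gj))

  G-even-disjoint : ∀ {i j x} → i < j → x ∈G[ k , 2 + double i ] → x ∈G[ k , 2 + double j ] → ⊥
  G-even-disjoint {i} {j} i<j x∈Gi x∈Gj = <-≤-<-irrefl (proj₂ (∈G-even j x∈Gj))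
    (ℚ.*-monoˡ-≤-nonNeg (ℕ→ℚ 2) (M-odd-antimono i<j)) (proj₁ (∈G-even i x∈Gi))

  G-odd-even-disjoint : ∀ i j {x} → x ∈G[ k , 1 + double i ] → x ∈G[ k , 2 + double j ] → ⊥
  G-odd-even-disjoint i j x∈Gi x∈Gj = <-≤-<-irrefl (proj₂ (∈G-odd i x∈Gi))
    (ℚ.*-monoˡ-≤-nonNeg (ℕ→ℚ 2) (M-even≤M-odd (suc i) (suc j))) (proj₁ (∈G-even j x∈Gj))

proposition3 : ∀ (k : ℕ) → 3 ≤ k → ∀ (n n′ : ℕ) → 1 ≤ n → 1 ≤ n′ → n ≢ n′ →
                 ∀ (x : ℚ) → ¬ (x ∈G[ k , n ] × x ∈G[ k , n′ ])
proposition3 k@(suc _) (s≤s _) n n′ 1≤n 1≤n′ n≢n′ x (x∈Gn , x∈Gn′) with parity n | parity n′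
... | even zero    | _            = ℕ.<-irrefl refl 1≤n
... | _            | even zero    = ℕ.<-irrefl refl 1≤n′
... | odd i        | even (suc j) = G-odd-even-disjoint k i j x∈Gn x∈Gn′
... | even (suc i) | odd j        = G-odd-even-disjoint k j i x∈Gn′ x∈Gn
... | odd i        | odd j        with ℕ.<-cmp i j
...   | tri< i<j _ _  = G-odd-disjoint k i<j x∈Gn x∈Gn′
...   | tri≈ _ refl _ = n≢n′ refl
...   | tri> _ _ j<i  = G-odd-disjoint k j<i x∈Gn′ x∈Gn
proposition3 k@(suc _) (s≤s _) n n′ 1≤n 1≤n′ n≢n′ x (x∈Gn , x∈Gn′)
    | even (suc i) | even (suc j) with ℕ.<-cmp i j
...   | tri< i<j _ _  = G-even-disjoint k i<j x∈Gn x∈Gn′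
...   | tri≈ _ refl _ = n≢n′ refl
...   | tri> _ _ j<i  = G-even-disjoint k j<i x∈Gn′ x∈Gn
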